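{- For all $\phi,\chi\in\mathcal{L}_\blacktriangle$ and any state-label $w$: there is a closed $\mathbb{S}(\mathbf{K}^\blacktriangle_\mathbf{FDE})$ tree with root $\{w:\phi;\mathfrak{t},\ w:\chi;\overline{\mathfrak{t}}\}$ iff there is a closed $\mathbb{S}(\mathbf{K}^\blacktriangle_\mathbf{FDE})$ tree with root $\{w:\phi;\overline{\mathfrak{f}},\ w:\chi;\mathfrak{f}\}$.
   Context: Formulas of $\mathcal{L}_\blacktriangle$: $\phi::=p\mid\neg\phi\mid\phi\wedge\phi\mid\phi\vee\phi\mid\blacktriangle\phi$, $p$ in a countable set $\mathsf{Var}$. Calculus $\mathbb{S}(\mathbf{K}^\blacktriangle_\mathbf{FDE})$. Fix a countable set of state-labels and value-labels $\{\mathfrak{t},\mathfrak{f},\overline{\mathfrak{t}},\overline{\mathfrak{f}}\}$ (read: true, false, not-true, not-false). A labelled formula is $w:\phi;\mathfrak{v}$. Conventions: $\overline{\overline{\mathfrak{t}}}=\mathfrak{t}$, $\overline{\overline{\mathfrak{f}}}=\mathfrak{f}$; $\mathfrak{t}^\neg=\mathfrak{f}$, $\mathfrak{f}^\neg=\mathfrak{t}$, $\overline{\mathfrak{t}}^\neg=\overline{\mathfrak{f}}$, $\overline{\mathfrak{f}}^\neg=\overline{\mathfrak{t}}$; $w:\phi;\mathfrak{v}_1;\mathfrak{v}_2$ abbreviates $w:\phi;\mathfrak{v}_1$ and $w:\phi;\mathfrak{v}_2$. A tree is downward-branching with nodes being sets of labelled formulas and relational atoms $w\mathsf{R}w'$;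 a branch may be extended by the rules below (premises before $\Rightarrow$; $\{i,j\}=\{1,2\}$; $w_k,w_{k_1},w_{k_2}$ fresh on the branch): $\neg$: $w:\neg\phi;\mathfrak{t}\Rightarrow w:\phi;\mathfrak{f}$; $w:\neg\phi;\mathfrak{f}\Rightarrow w:\phi;\mathfrak{t}$; $w:\neg\phi;\overline{\mathfrak{t}}\Rightarrow w:\phi;\overline{\mathfrak{f}}$; $w:\neg\phi;\overline{\mathfrak{f}}\Rightarrow w:\phi;\overline{\mathfrak{t}}$. $\wedge$: $w:\phi_1\wedge\phi_2;\mathfrak{t}\Rightarrow w:\phi_1;\mathfrak{t}$ and $w:\phi_2;\mathfrak{t}$; $w:\phi_1\wedge\phi_2;\mathfrak{f}$, $w:\phi_i;\overline{\mathfrak{f}}\Rightarrow w:\phi_j;\mathfrak{f}$; $w:\phi_1\wedge\phi_2;\overline{\mathfrak{t}}$, $w:\phi_i;\mathfrak{t}\Rightarrow w:\phi_j;\overline{\mathfrak{t}}$; $w:\phi_1\wedge\phi_2;\overline{\mathfrak{f}}\Rightarrow w:\phi_1;\overline{\mathfrak{f}}$ and $w:\phi_2;\overline{\mathfrak{f}}$. $\vee$: $w:\phi_1\vee\phi_2;\mathfrak{t}$, $w:\phi_i;\overline{\mathfrak{t}}\Rightarrow w:\phi_j;\mathfrak{t}$; $w:\phi_1\vee\phi_2;\mathfrak{f}\Rightarrow w:\phi_1;\mathfrak{f}$ and $w:\phi_2;\mathfrak{f}$; $w:\phi_1\vee\phi_2;\overline{\mathfrak{t}}\Rightarrow w:\phi_1;\overline{\mathfrak{t}}$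 and $w:\phi_2;\overline{\mathfrak{t}}$; $w:\phi_1\vee\phi_2;\overline{\mathfrak{f}}$, $w:\phi_i;\mathfrak{f}\Rightarrow w:\phi_j;\overline{\mathfrak{f}}$. Cut: with no premises, split the branch into $w:\phi;\mathfrak{v}\mid w:\phi;\overline{\mathfrak{v}}$, provided $\phi$ is a subformula of a formula on the branch and $w$ occurs on the branch. $\blacktriangle_T$: $w_i:\blacktriangle\phi;\mathfrak{t};\overline{\mathfrak{f}}$, $w_i\mathsf{R}w_j$, $w_j:\phi;\mathfrak{v}\Rightarrow w_j:\phi;\overline{\mathfrak{v}}^\neg$. $\blacktriangle'_T$: $w_i:\blacktriangle\phi;\mathfrak{t};\overline{\mathfrak{f}}$, $w_i\mathsf{R}w_{j_1}$, $w_i\mathsf{R}w_{j_2}$, $w_{j_1}:\phi;\mathfrak{v};\overline{\mathfrak{v}}^\neg\Rightarrow w_{j_2}:\phi;\mathfrak{v};\overline{\mathfrak{v}}^\neg$. $\blacktriangle_F$: $w_i:\blacktriangle\phi;\mathfrak{f};\overline{\mathfrak{t}}\Rightarrow$ add $w_i\mathsf{R}w_{k_1}$, $w_i\mathsf{R}w_{k_2}$, then split into $\{w_{k_1}:\phi;\mathfrak{t},\ w_{k_2}:\phi;\overline{\mathfrak{t}}\}\mid\{w_{k_1}:\phi;\mathfrak{f},\ w_{k_2}:\phi;\overline{\mathfrak{f}}\}$. $\blacktriangle_B$: $w_i:\blacktriangle\phi;\mathfrak{t};\mathfrak{f}$, $w_i\mathsf{R}w_j\Rightarrow w_j:\phi;\mathfrak{t};\mathfrak{f}$.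 $\blacktriangle^+_B$: $w_i:\blacktriangle\phi;\mathfrak{t};\mathfrak{f}\Rightarrow w_i\mathsf{R}w_k$, $w_k:\phi;\mathfrak{t};\mathfrak{f}$. $\blacktriangle_N$: $w_i:\blacktriangle\phi;\overline{\mathfrak{t}};\overline{\mathfrak{f}}$, $w_i\mathsf{R}w_j\Rightarrow w_j:\phi;\overline{\mathfrak{t}};\overline{\mathfrak{f}}$. $\blacktriangle^+_N$: $w_i:\blacktriangle\phi;\overline{\mathfrak{t}};\overline{\mathfrak{f}}\Rightarrow w_i\mathsf{R}w_k$, $w_k:\phi;\overline{\mathfrak{t}};\overline{\mathfrak{f}}$. A branch is closed iff it contains $w:\phi;\mathfrak{v}$ and $w:\phi;\overline{\mathfrak{v}}$ for some $w,\phi,\mathfrak{v}$; a tree is closed iff all its branches are closed. -}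

module Defs where

open import Data.Nat using (ℕ)
open import Data.List using (List; []; _∷_)
open import Data.List.Membership.Propositional using (_∈_)
open import Data.List.Relation.Unary.Any using (Any)
open import Data.Product using (∃; ∃-syntax; _×_)
open import Relation.Binary.PropositionalEquality using (_≡_)
open import Relation.Nullary using (¬_)

data Fm : Set where
  var : ℕ → Fm
  ~_  : Fm → Fm
  _∧_ : Fm → Fm → Fm
  _∨_ : Fm → Fm → Fm
  ▲_  : Fm → Fm

data _⊑_ : Fm → Fm → Set where
  ⊑-refl : ∀ {φ} → φ ⊑ φ
  ⊑-~    : ∀ {φ ψ} → φ ⊑ ψ → φ ⊑ (~ ψ)
  ⊑-∧ˡ   : ∀ {φ ψ χ} → φ ⊑ ψ → φ ⊑ (ψ ∧ χ)
  ⊑-∧ʳ   : ∀ {φ ψ χ} → φ ⊑ χ → φ ⊑ (ψ ∧ χ)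
  ⊑-∨ˡ   : ∀ {φ ψ χ} → φ ⊑ ψ → φ ⊑ (ψ ∨ χ)
  ⊑-∨ʳ   : ∀ {φ ψ χ} → φ ⊑ χ → φ ⊑ (ψ ∨ χ)
  ⊑-▲    : ∀ {φ ψ} → φ ⊑ ψ → φ ⊑ (▲ ψ)

-- Value labels: t (true), f (false), t̄ (not-true), f̄ (not-false)
data VL : Set where
  𝔱 𝔣 𝔱̄ 𝔣̄ : VL

bar : VL → VL
bar 𝔱 = 𝔱̄
bar 𝔣 = 𝔣̄
bar 𝔱̄ = 𝔱
bar 𝔣̄ = 𝔣

negV : VL → VL
negV 𝔱 = 𝔣
negV 𝔣 = 𝔱
negV 𝔱̄ = 𝔣̄
negV 𝔣̄ = 𝔱̄

State : Set
State = ℕ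

-- Entries of a branch: labelled formulas  w : φ ; v  and relational atoms  w R w'
data Entry : Set where
  lf  : State → Fm → VL → Entry
  rel : State → State → Entry

-- A branch, represented by the list of all entries on it (union of its nodes)
Branch : Set
Branch = List Entry

data OccursIn (w : State) : Entry → Set where
  occ-lf   : ∀ {φ v} → OccursIn w (lf w φ v)
  occ-relˡ : ∀ {u} → OccursIn w (rel w u)
  occ-relʳ : ∀ {u} → OccursIn w (rel u w)

Occurs : State → Branch → Set
Occurs w Γ = Any (OccursIn w) Γ

Fresh : State → Branch → Set
Fresh w Γ = ¬ Occurs w Γ

-- Closes Γ : there is a finite closed tree extending the branch Γ
-- (i.e. a closed S(K▲FDE) tree whose root is Γ, when Γ is the root node).
data Closes (Γ : Branch) : Set where
  closed : ∀ {w φ v} → lf w φ v ∈ Γ → lf w φ (bar v) ∈ Γ → Closes Γ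
  ¬𝔱 : ∀ {w φ} → lf w (~ φ) 𝔱 ∈ Γ → Closes (lf w φ 𝔣 ∷ Γ) → Closes Γ
  ¬𝔣 : ∀ {w φ} → lf w (~ φ) 𝔣 ∈ Γ → Closes (lf w φ 𝔱 ∷ Γ) → Closes Γ
  ¬𝔱̄ : ∀ {w φ} → lf w (~ φ) 𝔱̄ ∈ Γ → Closes (lf w φ 𝔣̄ ∷ Γ) → Closes Γ
  ¬𝔣̄ : ∀ {w φ} → lf w (~ φ) 𝔣̄ ∈ Γ → Closes (lf w φ 𝔱̄ ∷ Γ) → Closes Γ
  ∧𝔱  : ∀ {w φ₁ φ₂} → lf w (φ₁ ∧ φ₂) 𝔱 ∈ Γ
        → Closes (lf w φ₁ 𝔱 ∷ lf w φ₂ 𝔱 ∷ Γ) → Closes Γ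
  ∧𝔣₁ : ∀ {w φ₁ φ₂} → lf w (φ₁ ∧ φ₂) 𝔣 ∈ Γ → lf w φ₁ 𝔣̄ ∈ Γ
        → Closes (lf w φ₂ 𝔣 ∷ Γ) → Closes Γ
  ∧𝔣₂ : ∀ {w φ₁ φ₂} → lf w (φ₁ ∧ φ₂) 𝔣 ∈ Γ → lf w φ₂ 𝔣̄ ∈ Γ
        → Closes (lf w φ₁ 𝔣 ∷ Γ) → Closes Γ
  ∧𝔱̄₁ : ∀ {w φ₁ φ₂} → lf w (φ₁ ∧ φ₂) 𝔱̄ ∈ Γ → lf w φ₁ 𝔱 ∈ Γ
        → Closes (lf w φ₂ 𝔱̄ ∷ Γ) → Closes Γ
  ∧𝔱̄₂ : ∀ {w φ₁ φ₂} → lf w (φ₁ ∧ φ₂) 𝔱̄ ∈ Γ → lf w φ₂ 𝔱 ∈ Γ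
        → Closes (lf w φ₁ 𝔱̄ ∷ Γ) → Closes Γ
  ∧𝔣̄  : ∀ {w φ₁ φ₂} → lf w (φ₁ ∧ φ₂) 𝔣̄ ∈ Γ
        → Closes (lf w φ₁ 𝔣̄ ∷ lf w φ₂ 𝔣̄ ∷ Γ) → Closes Γ
  ∨𝔱₁ : ∀ {w φ₁ φ₂} → lf w (φ₁ ∨ φ₂) 𝔱 ∈ Γ → lf w φ₁ 𝔱̄ ∈ Γ
        → Closes (lf w φ₂ 𝔱 ∷ Γ) → Closes Γ
  ∨𝔱₂ : ∀ {w φ₁ φ₂} → lf w (φ₁ ∨ φ₂) 𝔱 ∈ Γ → lf w φ₂ 𝔱̄ ∈ Γ
        → Closes (lf w φ₁ 𝔱 ∷ Γ) → Closes Γ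
  ∨𝔣  : ∀ {w φ₁ φ₂} → lf w (φ₁ ∨ φ₂) 𝔣 ∈ Γ
        → Closes (lf w φ₁ 𝔣 ∷ lf w φ₂ 𝔣 ∷ Γ) → Closes Γ
  ∨𝔱̄  : ∀ {w φ₁ φ₂} → lf w (φ₁ ∨ φ₂) 𝔱̄ ∈ Γ
        → Closes (lf w φ₁ 𝔱̄ ∷ lf w φ₂ 𝔱̄ ∷ Γ) → Closes Γ
  ∨𝔣̄₁ : ∀ {w φ₁ φ₂} → lf w (φ₁ ∨ φ₂) 𝔣̄ ∈ Γ → lf w φ₁ 𝔣 ∈ Γ
        → Closes (lf w φ₂ 𝔣̄ ∷ Γ) → Closes Γ
  ∨𝔣̄₂ : ∀ {w φ₁ φ₂} → lf w (φ₁ ∨ φ₂) 𝔣̄ ∈ Γ → lf w φ₂ 𝔣 ∈ Γ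
        → Closes (lf w φ₁ 𝔣̄ ∷ Γ) → Closes Γ
  cut : ∀ {w φ v u ψ v'} → φ ⊑ ψ → lf u ψ v' ∈ Γ → Occurs w Γ
        → Closes (lf w φ v ∷ Γ) → Closes (lf w φ (bar v) ∷ Γ) → Closes Γ
  ▲T  : ∀ {i j φ v} → lf i (▲ φ) 𝔱 ∈ Γ → lf i (▲ φ) 𝔣̄ ∈ Γ → rel i j ∈ Γ
        → lf j φ v ∈ Γ
        → Closes (lf j φ (negV (bar v)) ∷ Γ) → Closes Γ
  ▲T′ : ∀ {i j₁ j₂ φ v} → lf i (▲ φ) 𝔱 ∈ Γ → lf i (▲ φ) 𝔣̄ ∈ Γ
        → rel i j₁ ∈ Γ → rel i j₂ ∈ Γ
        → lf j₁ φ v ∈ Γ → lf j₁ φ (negV (bar v)) ∈ Γ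
        → Closes (lf j₂ φ v ∷ lf j₂ φ (negV (bar v)) ∷ Γ) → Closes Γ
  ▲F  : ∀ {i φ k₁ k₂} → lf i (▲ φ) 𝔣 ∈ Γ → lf i (▲ φ) 𝔱̄ ∈ Γ
        → Fresh k₁ Γ → Fresh k₂ Γ → ¬ (k₁ ≡ k₂)
        → Closes (lf k₁ φ 𝔱 ∷ lf k₂ φ 𝔱̄ ∷ rel i k₁ ∷ rel i k₂ ∷ Γ)
        → Closes (lf k₁ φ 𝔣 ∷ lf k₂ φ 𝔣̄ ∷ rel i k₁ ∷ rel i k₂ ∷ Γ)
        → Closes Γ
  ▲B  : ∀ {i j φ} → lf i (▲ φ) 𝔱 ∈ Γ → lf i (▲ φ) 𝔣 ∈ Γ → rel i j ∈ Γ
        → Closes (lf j φ 𝔱 ∷ lf j φ 𝔣 ∷ Γ) → Closes Γ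
  ▲B⁺ : ∀ {i k φ} → lf i (▲ φ) 𝔱 ∈ Γ → lf i (▲ φ) 𝔣 ∈ Γ → Fresh k Γ
        → Closes (rel i k ∷ lf k φ 𝔱 ∷ lf k φ 𝔣 ∷ Γ) → Closes Γ
  ▲N  : ∀ {i j φ} → lf i (▲ φ) 𝔱̄ ∈ Γ → lf i (▲ φ) 𝔣̄ ∈ Γ → rel i j ∈ Γ
        → Closes (lf j φ 𝔱̄ ∷ lf j φ 𝔣̄ ∷ Γ) → Closes Γ
  ▲N⁺ : ∀ {i k φ} → lf i (▲ φ) 𝔱̄ ∈ Γ → lf i (▲ φ) 𝔣̄ ∈ Γ → Fresh k Γ
        → Closes (rel i k ∷ lf k φ 𝔱̄ ∷ lf k φ 𝔣̄ ∷ Γ) → Closes Γ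

{-# OPTIONS --safe #-}
-- The relabelling v ↦ (bar v)^¬, which swaps 𝔱 with 𝔣̄ and 𝔣 with 𝔱̄, is an involution
-- commuting with the bar.  It permutes the rules of the calculus: the 𝔱-rules with the
-- 𝔣̄-rules, the 𝔣-rules with the 𝔱̄-rules, ▲B with ▲N and ▲B⁺ with ▲N⁺, while ▲T, ▲T′ and
-- cut are mapped to themselves and ▲F to itself with its two fresh states and its two
-- branches exchanged.  Relabelling a closed tree therefore gives a closed tree, and the
-- relabelling exchanges the two roots.
module Submission where

open import Defs
open import Data.List using ([]; _∷_)
open import Data.List.Membership.Propositional using (_∈_; lose; find)
open import Data.List.Relation.Unary.Any using (here; there)
open import Data.List.Relation.Binary.Permutation.Propositional using (_↭_; ↭-refl; ↭-prep; ↭-swap; ↭-sym)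
open import Data.List.Relation.Binary.Permutation.Propositional.Properties using (∈-resp-↭)
open import Data.Product using (_,_)
open import Function.Bundles using (_⇔_; mk⇔)
open import Relation.Binary.PropositionalEquality using (_≡_; refl; sym; subst; cong)

dual : VL → VL
dual v = negV (bar v)

dual-involutive : ∀ v → dual (dual v) ≡ v
dual-involutive 𝔱 = refl
dual-involutive 𝔣 = refl
dual-involutive 𝔱̄ = refl
dual-involutive 𝔣̄ = refl

dual-bar : ∀ v → dual (bar v) ≡ bar (dual v)
dual-bar 𝔱 = refl
dual-bar 𝔣 = refl
dual-bar 𝔱̄ = refl
dual-bar 𝔣̄ = refl

dualᴱ : Entry → Entry
dualᴱ (lf w φ v) = lf w φ (dual v)
dualᴱ (rel u w)  = rel u w

dualᴱ-involutive : ∀ e → dualᴱ (dualᴱ e) ≡ e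
dualᴱ-involutive (lf w φ v) = cong (lf w φ) (dual-involutive v)
dualᴱ-involutive (rel u w)  = refl

OccursIn-dualᴱ : ∀ {w e} → OccursIn w e → OccursIn w (dualᴱ e)
OccursIn-dualᴱ occ-lf   = occ-lf
OccursIn-dualᴱ occ-relˡ = occ-relˡ
OccursIn-dualᴱ occ-relʳ = occ-relʳ

-- Δ is the relabelling of Γ up to order and repetition: dual rules add their conclusions
-- in different orders, and Closes depends only on membership.
record Dual (Γ Δ : Branch) : Set where
  field
    to   : ∀ {e} → e ∈ Γ → dualᴱ e ∈ Δ
    from : ∀ {e} → e ∈ Δ → dualᴱ e ∈ Γ

open Dual

Dual-sym : ∀ {Γ Δ} → Dual Γ Δ → Dual Δ Γ
Dual-sym s = record { to = from s ; from = to s }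

Dual-[] : Dual [] []
Dual-[] = record { to = λ () ; from = λ () }

Dual-∷ : ∀ {e Γ Δ} → Dual Γ Δ → Dual (e ∷ Γ) (dualᴱ e ∷ Δ)
Dual-∷ {e} s = record { to = to′ ; from = from′ }
  where
  to′ : ∀ {x} → x ∈ e ∷ _ → dualᴱ x ∈ dualᴱ e ∷ _
  to′ (here refl) = here refl
  to′ (there p)   = there (to s p)
  from′ : ∀ {x} → x ∈ dualᴱ e ∷ _ → dualᴱ x ∈ e ∷ _
  from′ (here refl) = here (dualᴱ-involutive e)
  from′ (there p)   = there (from s p)

Dual-resp-↭ : ∀ {Γ Δ Δ′} → Δ ↭ Δ′ → Dual Γ Δ → Dual Γ Δ′
Dual-resp-↭ p s = record
  { to   = λ e∈Γ → ∈-resp-↭ p (to s e∈Γ)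
  ; from = λ e∈Δ′ → from s (∈-resp-↭ (↭-sym p) e∈Δ′)
  }

Occurs-dual : ∀ {w Γ Δ} → Dual Γ Δ → Occurs w Γ → Occurs w Δ
Occurs-dual s o with find o
... | e , e∈Γ , occ = lose (to s e∈Γ) (OccursIn-dualᴱ occ)

Fresh-dual : ∀ {k Γ Δ} → Dual Γ Δ → Fresh k Γ → Fresh k Δ
Fresh-dual s fresh o = fresh (Occurs-dual (Dual-sym s) o)

Closes-dual : ∀ {Γ Δ} → Closes Γ → Dual Γ Δ → Closes Δ
Closes-dual {Δ = Δ} (closed {w} {φ} {v} p q) s =
  closed (to s p) (subst (λ u → lf w φ u ∈ Δ) (dual-bar v) (to s q))
Closes-dual (¬𝔱 p c) s = ¬𝔣̄ (to s p) (Closes-dual c (Dual-∷ s))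
Closes-dual (¬𝔣 p c) s = ¬𝔱̄ (to s p) (Closes-dual c (Dual-∷ s))
Closes-dual (¬𝔱̄ p c) s = ¬𝔣 (to s p) (Closes-dual c (Dual-∷ s))
Closes-dual (¬𝔣̄ p c) s = ¬𝔱 (to s p) (Closes-dual c (Dual-∷ s))
Closes-dual (∧𝔱 p c) s = ∧𝔣̄ (to s p) (Closes-dual c (Dual-∷ (Dual-∷ s)))
Closes-dual (∧𝔣₁ p q c) s = ∧𝔱̄₁ (to s p) (to s q) (Closes-dual c (Dual-∷ s))
Closes-dual (∧𝔣₂ p q c) s = ∧𝔱̄₂ (to s p) (to s q) (Closes-dual c (Dual-∷ s))
Closes-dual (∧𝔱̄₁ p q c) s = ∧𝔣₁ (to s p) (to s q) (Closes-dual c (Dual-∷ s))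
Closes-dual (∧𝔱̄₂ p q c) s = ∧𝔣₂ (to s p) (to s q) (Closes-dual c (Dual-∷ s))
Closes-dual (∧𝔣̄ p c) s = ∧𝔱 (to s p) (Closes-dual c (Dual-∷ (Dual-∷ s)))
Closes-dual (∨𝔱₁ p q c) s = ∨𝔣̄₁ (to s p) (to s q) (Closes-dual c (Dual-∷ s))
Closes-dual (∨𝔱₂ p q c) s = ∨𝔣̄₂ (to s p) (to s q) (Closes-dual c (Dual-∷ s))
Closes-dual (∨𝔣 p c) s = ∨𝔱̄ (to s p) (Closes-dual c (Dual-∷ (Dual-∷ s)))
Closes-dual (∨𝔱̄ p c) s = ∨𝔣 (to s p) (Closes-dual c (Dual-∷ (Dual-∷ s)))
Closes-dual (∨𝔣̄₁ p q c) s = ∨𝔱₁ (to s p) (to s q) (Closes-dual c (Dual-∷ s))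
Closes-dual (∨𝔣̄₂ p q c) s = ∨𝔱₂ (to s p) (to s q) (Closes-dual c (Dual-∷ s))
Closes-dual {Δ = Δ} (cut {w} {φ} {v} sub p o c₁ c₂) s =
  cut {v = dual v} sub (to s p) (Occurs-dual s o)
    (Closes-dual c₁ (Dual-∷ s))
    (subst (λ u → Closes (lf w φ u ∷ Δ)) (dual-bar v) (Closes-dual c₂ (Dual-∷ s)))
Closes-dual (▲T p q r m c) s =
  ▲T (to s q) (to s p) (to s r) (to s m) (Closes-dual c (Dual-∷ s))
Closes-dual (▲T′ p q r₁ r₂ m₁ m₂ c) s =
  ▲T′ (to s q) (to s p) (to s r₁) (to s r₂) (to s m₁) (to s m₂)
    (Closes-dual c (Dual-∷ (Dual-∷ s)))
Closes-dual (▲F p q fresh₁ fresh₂ k₁≢k₂ c₁ c₂) s =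
  ▲F (to s q) (to s p) (Fresh-dual s fresh₂) (Fresh-dual s fresh₁) (λ eq → k₁≢k₂ (sym eq))
    (Closes-dual c₂ (Dual-resp-↭ swap-pairs (Dual-∷ (Dual-∷ (Dual-∷ (Dual-∷ s))))))
    (Closes-dual c₁ (Dual-resp-↭ swap-pairs (Dual-∷ (Dual-∷ (Dual-∷ (Dual-∷ s))))))
  where
  swap-pairs : ∀ {a b c d Γ} → a ∷ b ∷ c ∷ d ∷ Γ ↭ b ∷ a ∷ d ∷ c ∷ Γ
  swap-pairs = ↭-swap _ _ (↭-swap _ _ ↭-refl)
Closes-dual (▲B p q r c) s =
  ▲N (to s q) (to s p) (to s r) (Closes-dual c (Dual-resp-↭ (↭-swap _ _ ↭-refl) (Dual-∷ (Dual-∷ s))))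
Closes-dual (▲B⁺ p q fresh c) s =
  ▲N⁺ (to s q) (to s p) (Fresh-dual s fresh)
    (Closes-dual c (Dual-resp-↭ (↭-prep _ (↭-swap _ _ ↭-refl)) (Dual-∷ (Dual-∷ (Dual-∷ s)))))
Closes-dual (▲N p q r c) s =
  ▲B (to s q) (to s p) (to s r) (Closes-dual c (Dual-resp-↭ (↭-swap _ _ ↭-refl) (Dual-∷ (Dual-∷ s))))
Closes-dual (▲N⁺ p q fresh c) s =
  ▲B⁺ (to s q) (to s p) (Fresh-dual s fresh)
    (Closes-dual c (Dual-resp-↭ (↭-prep _ (↭-swap _ _ ↭-refl)) (Dual-∷ (Dual-∷ (Dual-∷ s)))))

corollary1 : (φ χ : Fm) (w : State)
    → Closes (lf w φ 𝔱 ∷ lf w χ 𝔱̄ ∷ []) ⇔ Closes (lf w φ 𝔣̄ ∷ lf w χ 𝔣 ∷ [])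
corollary1 φ χ w = mk⇔ (λ c → Closes-dual c roots-dual) (λ c → Closes-dual c roots-dual)
  where
  roots-dual : ∀ {a b} → Dual (a ∷ b ∷ []) (dualᴱ a ∷ dualᴱ b ∷ [])
  roots-dual = Dual-∷ (Dual-∷ Dual-[])
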